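{- Let $q$ be a prime power, $\theta$ a generator of $\mathbb{F}_{q^2}^*$, $A=\{a\in\mathbb{Z}_{q^2-1} : \theta^a-\theta\in\mathbb{F}_q\}$, and $H=\{0,q+1,2(q+1),\dots,(q-2)(q+1)\}$ the subgroup of $\mathbb{Z}_{q^2-1}$ generated by $q+1$. If $x$ and $y$ are distinct vertices of $G_{q,\theta}$, then: (i) $d(x,y)=1$ if and only if $x+y\in A$; (ii) $d(x,y)=2$ if and only if $x+y\notin A$ and $x-y\notin H$; (iii) $d(x,y)=3$ if and only if $x+y\notin A$ and $x-y\in H$.
   Context: $G_{q,\theta}$ is the simple graph (no loops) with vertex set $\mathbb{Z}_{q^2-1}$ in which two distinct vertices $x,y$ are adjacent if and only if $x+y\in A$. $d(x,y)$ denotes the graph distance in $G_{q,\theta}$. -}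

module Defs where

open import Level using (Level; _⊔_) renaming (suc to lsuc)
import Algebra.Bundles
open Algebra.Bundles using (CommutativeRing)
import Algebra.Definitions.RawSemiring as RawSemiringDefs
open import Data.Nat using (ℕ; zero; suc; _<_)
import Data.Nat as ℕ
open import Data.Nat.Primality using (Prime)
open import Data.Fin using (Fin; toℕ)
open import Data.Integer as ℤ using (ℤ; +_)
open import Data.Integer.Divisibility as ℤD using ()
open import Data.Product using (Σ; ∃; ∃₂; _×_)
open import Relation.Nullary using (¬_)
open import Relation.Binary.PropositionalEquality using (_≡_; _≢_)

IsPrimePower : ℕ → Set
IsPrimePower q = ∃₂ λ p k → Prime p × q ≡ p ℕ.^ suc k

module _ {c ℓ : Level} (K : CommutativeRing c ℓ) where
  open CommutativeRing K using (Carrier; _≈_; _+_; _*_; -_; _-_; 0#; 1#; semiring)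
  open RawSemiringDefs (Algebra.Bundles.Semiring.rawSemiring semiring) using (_^_)

  record IsFieldOfOrder (n : ℕ) : Set (c ⊔ ℓ) where
    field
      1≉0      : ¬ (1# ≈ 0#)
      inverse  : ∀ x → ¬ (x ≈ 0#) → ∃ λ y → x * y ≈ 1#
      enum     : Fin n → Carrier
      enum-inj : ∀ i j → enum i ≈ enum j → i ≡ j
      enum-sur : ∀ x → ∃ λ i → enum i ≈ x

  record IsSubfieldOfOrder {p : Level} (P : Carrier → Set p) (m : ℕ) : Set (c ⊔ ℓ ⊔ p) where
    field
      P-resp   : ∀ {x y} → x ≈ y → P x → P y
      P-0      : P 0#
      P-1      : P 1#
      P-+      : ∀ {x y} → P x → P y → P (x + y)
      P-neg    : ∀ {x} → P x → P (- x)
      P-*      : ∀ {x y} → P x → P y → P (x * y)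
      P-inv    : ∀ {x y} → P x → x * y ≈ 1# → P y
      enum     : Fin m → Carrier
      enum-P   : ∀ i → P (enum i)
      enum-inj : ∀ i j → enum i ≈ enum j → i ≡ j
      enum-sur : ∀ x → P x → ∃ λ i → enum i ≈ x

  record IsPrimitive (θ : Carrier) : Set (c ⊔ ℓ) where
    field
      θ≉0      : ¬ (θ ≈ 0#)
      generates : ∀ x → ¬ (x ≈ 0#) → ∃ λ a → θ ^ a ≈ x

  -- a ∈ A  iff  θ^a - θ ∈ F_q  (a a natural-number representative of a residue mod q²-1;
  -- well defined since θ^(q²-1) = 1)
  InA : {p : Level} (P : Carrier → Set p) (θ : Carrier) → ℕ → Set p
  InA P θ a = P (θ ^ a - θ)

  Adj : {p : Level} (q : ℕ) (P : Carrier → Set p) (θ : Carrier) →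
        Fin (q ℕ.* q ℕ.∸ 1) → Fin (q ℕ.* q ℕ.∸ 1) → Set p
  Adj q P θ x y = (x ≢ y) × InA P θ (toℕ x ℕ.+ toℕ y)

  data Walk {p : Level} (q : ℕ) (P : Carrier → Set p) (θ : Carrier) :
            Fin (q ℕ.* q ℕ.∸ 1) → Fin (q ℕ.* q ℕ.∸ 1) → ℕ → Set (c ⊔ ℓ ⊔ p) where
    here : ∀ {x} → Walk q P θ x x zero
    step : ∀ {x y z n} → Adj q P θ x y → Walk q P θ y z n → Walk q P θ x z (suc n)

  Dist : {p : Level} (q : ℕ) (P : Carrier → Set p) (θ : Carrier) →
         Fin (q ℕ.* q ℕ.∸ 1) → Fin (q ℕ.* q ℕ.∸ 1) → ℕ → Set (c ⊔ ℓ ⊔ p)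
  Dist q P θ x y k = Walk q P θ x y k × (∀ m → m < k → ¬ Walk q P θ x y m)

InH : (q : ℕ) → Fin (q ℕ.* q ℕ.∸ 1) → Fin (q ℕ.* q ℕ.∸ 1) → Set
InH q x y = ∃ λ k → k < q ℕ.∸ 1 ×
  (+ (q ℕ.* q ℕ.∸ 1)) ℤD.∣ ((+ toℕ x ℤ.- + toℕ y) ℤ.- + (k ℕ.* (q ℕ.+ 1)))

-- Identify a vertex x with θ ^ x ∈ 𝔽*_{q²} and write N = q² − 1. As 𝔽*_{q²} is cyclic of order N
-- and 𝔽*_q has q − 1 elements, θ ^ d ∈ 𝔽_q exactly when q + 1 ∣ d, so x − y ∈ H means
-- θ ^ x ∈ 𝔽*_q · θ ^ y. Since θ ∉ 𝔽_q, {θ, 1} is an 𝔽_q-basis of 𝔽_{q²}; hence if c ∈ 𝔽_q and both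
-- v and c v lie in the coset θ + 𝔽_q, then c = 1.
-- A common neighbour z of x and y puts θ ^ (x + z) and θ ^ (y + z) in θ + 𝔽_q; when x − y ∈ H their
-- ratio is in 𝔽_q, so it is 1 and x = y. When x − y ∉ H, u = θ ^ (x − y) ∉ 𝔽_q, solving
-- u (θ + t) = θ + s in the basis gives t, s ∈ 𝔽_q, and the vertex z with θ ^ (z + y) = θ + t is a
-- common neighbour. Finally, when x − y ∈ H and x + y ∉ A, one of the two neighbours z of x with
-- θ ^ (x + z) ∈ {θ, θ + 1} has z ≠ x and z − y ∉ H, and a common neighbour of z and y closes a
-- path of length 3.

module Submission where

open import Defs
open import Level using (Level; _⊔_)
open import Algebra.Bundles using (CommutativeRing)
import Algebra.Definitions.RawSemiring as RawSemiringDefs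
open import Data.Empty using (⊥-elim)
open import Data.Fin as Fin using (Fin; toℕ)
import Data.Fin.Properties as FinP
open import Data.Integer as ℤ using (ℤ; +_)
import Data.Integer.Divisibility as ℤD
import Data.Integer.Divisibility.Signed as ℤS
import Data.Integer.Properties as ℤP
open import Data.Integer.Solver using (module +-*-Solver)
open import Data.Nat as ℕ using (ℕ; zero; suc; z≤n; s≤s; _<_; _≤_; _∸_; NonZero)
open import Data.Nat.Divisibility as ℕD using (_∣_; divides)
open import Data.Nat.DivMod using (_%_; _/_; m%n<n; m≡m%n+[m/n]*n)
import Data.Nat.Properties as ℕP
open import Data.Nat.Solver using () renaming (module +-*-Solver to ℕSolver)
open import Data.Product
open import Data.Sum using (_⊎_; inj₁; inj₂)
open import Data.Vec.Functional using (_∷_)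
open import Function.Base using (_∘_)
open import Function.Bundles using (_⇔_; mk⇔; Equivalence)
open import Function.Construct.Composition using (_⇔-∘_)
open import Function.Construct.Symmetry using (⇔-sym)
open import Relation.Binary.Bundles using (Setoid)
open import Relation.Binary.Definitions using (Decidable; tri<; tri≈; tri>)
open import Relation.Binary.PropositionalEquality as ≡ using (_≡_; _≢_)
open import Relation.Nullary using (¬_; Dec; yes; no)
open import Relation.Nullary.Decidable as Dec using (map′; ¬?; decidable-stable)
import Relation.Unary as U

least-witness : ∀ {p} {Q : ℕ → Set p} → U.Decidable Q → ∀ {b} → Q b →
                ∃ λ k → Q k × ∀ j → j < k → ¬ Q j
least-witness {Q = Q} Q? {b} Qb with FinP.¬∀⟶∃¬-smallest (suc b) (λ i → ¬ Q (toℕ i)) (λ i → ¬? (Q? (toℕ i)))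
                                      (λ ¬Q → ¬Q (Fin.fromℕ b) (≡.subst Q (≡.sym (FinP.toℕ-fromℕ b)) Qb))
... | i , ¬¬Qi , below-i = toℕ i , decidable-stable (Q? (toℕ i)) ¬¬Qi , none-below
  where
  none-below : ∀ j → j < toℕ i → ¬ Q j
  none-below j j<i = ≡.subst (¬_ ∘ Q) (≡.trans (FinP.toℕ-inject (Fin.fromℕ< j<i)) (FinP.toℕ-fromℕ< j<i))
                       (below-i (Fin.fromℕ< j<i))

q*q∸1≡[q∸1]*[q+1] : ∀ q → q ℕ.* q ∸ 1 ≡ (q ∸ 1) ℕ.* (q ℕ.+ 1)
q*q∸1≡[q∸1]*[q+1] zero    = ≡.refl
q*q∸1≡[q∸1]*[q+1] (suc k) = solve 1 (λ k → k :+ k :* (con 1 :+ k) := k :* ((con 1 :+ k) :+ con 1)) ≡.refl k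
  where open ℕSolver

+a-+b≡+[a∸b] : ∀ {a b} → b ≤ a → + a ℤ.- + b ≡ + (a ∸ b)
+a-+b≡+[a∸b] {a} {b} b≤a = ≡.trans (ℤP.m-n≡m⊖n a b) (ℤP.⊖-≥ b≤a)

module _ {m d N : ℕ} (N≡m*d : N ≡ m ℕ.* d) {X Y : ℕ} (X<N : X < N) (Y<N : Y < N) where
  open +-*-Solver
  open ≡.≡-Reasoning

  private
    D : ℕ
    D = X ℕ.+ (N ∸ Y)

    X-Y≡D-N : + X ℤ.- + Y ≡ + D ℤ.- + N
    X-Y≡D-N = begin
      + X ℤ.- + Y                      ≡⟨ solve 3 (λ x y n → x :- y := (x :+ (n :- y)) :- n) ≡.refl (+ X) (+ Y) (+ N) ⟩
      (+ X ℤ.+ (+ N ℤ.- + Y)) ℤ.- + N  ≡⟨ ≡.cong (λ w → (+ X ℤ.+ w) ℤ.- + N) (+a-+b≡+[a∸b] (ℕP.<⇒≤ Y<N)) ⟩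
      + D ℤ.- + N                      ∎

    offset : ℕ → ℤ
    offset k = (+ X ℤ.- + Y) ℤ.- + (k ℕ.* d)

  ∣X+[N∸Y]⇔X-Y∈d·ℤ/N : d ∣ X ℕ.+ (N ∸ Y) ⇔ ∃ λ k → k < m × + N ℤD.∣ (+ X ℤ.- + Y) ℤ.- + (k ℕ.* d)
  ∣X+[N∸Y]⇔X-Y∈d·ℤ/N = mk⇔ to from
    where
    -- D < 2N, so D = j d with j < 2m: k = j makes the offset −N, and k = j − m makes it 0.
    to : d ∣ D → ∃ λ k → k < m × + N ℤD.∣ offset k
    to (divides j D≡jd) with j ℕ.<? m
    ... | yes j<m = j , j<m , ≡.subst (N ∣_) ∣offset∣≡N ℕD.∣-refl
      where
      ∣offset∣≡N : N ≡ ℤ.∣ offset j ∣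
      ∣offset∣≡N = begin
        N                              ≡⟨ ℤP.∣-i∣≡∣i∣ (+ N) ⟨
        ℤ.∣ ℤ.- + N ∣                  ≡⟨ ≡.cong ℤ.∣_∣ (solve 2 (λ n t → :- n := (t :- n) :- t) ≡.refl (+ N) (+ D)) ⟩
        ℤ.∣ (+ D ℤ.- + N) ℤ.- + D ∣    ≡⟨ ≡.cong₂ (λ u v → ℤ.∣ u ℤ.- + v ∣) (≡.sym X-Y≡D-N) D≡jd ⟩
        ℤ.∣ offset j ∣                 ∎
    ... | no j≮m = j ∸ m , j∸m<m , ≡.subst (N ∣_) (≡.cong ℤ.∣_∣ offset≡0) (ℕD._∣0 N)
      where
      N≤D : N ≤ D
      N≤D = ≡.subst₂ _≤_ (≡.sym N≡m*d) (≡.sym D≡jd) (ℕP.*-monoˡ-≤ d (ℕP.≮⇒≥ j≮m))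
      [j∸m]d≡D∸N : (j ∸ m) ℕ.* d ≡ D ∸ N
      [j∸m]d≡D∸N = ≡.trans (ℕP.*-distribʳ-∸ d j m) (≡.sym (≡.cong₂ _∸_ D≡jd N≡m*d))
      D∸N<N : D ∸ N < N
      D∸N<N = ℕP.+-cancelʳ-< N (D ∸ N) N
                (≡.subst (_< N ℕ.+ N) (≡.sym (ℕP.m∸n+n≡m N≤D)) (ℕP.+-mono-<-≤ X<N (ℕP.m∸n≤m N Y)))
      j∸m<m : j ∸ m < m
      j∸m<m = ℕP.*-cancelʳ-< d (j ∸ m) m (≡.subst₂ _<_ (≡.sym [j∸m]d≡D∸N) N≡m*d D∸N<N)
      offset≡0 : + 0 ≡ offset (j ∸ m)
      offset≡0 = begin
        + 0                                ≡⟨ solve 1 (λ t → con (+ 0) := t :- t) ≡.refl (+ D ℤ.- + N) ⟩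
        (+ D ℤ.- + N) ℤ.- (+ D ℤ.- + N)    ≡⟨ ≡.cong (λ u → u ℤ.- (+ D ℤ.- + N)) X-Y≡D-N ⟨
        (+ X ℤ.- + Y) ℤ.- (+ D ℤ.- + N)    ≡⟨ ≡.cong (λ u → (+ X ℤ.- + Y) ℤ.- u) (+a-+b≡+[a∸b] N≤D) ⟩
        (+ X ℤ.- + Y) ℤ.- + (D ∸ N)        ≡⟨ ≡.cong (λ u → (+ X ℤ.- + Y) ℤ.- + u) [j∸m]d≡D∸N ⟨
        offset (j ∸ m)                     ∎

    from : (∃ λ k → k < m × + N ℤD.∣ offset k) → d ∣ D
    from (k , _ , N∣offset) = ℤS.∣⇒∣ᵤ {+ d} {+ D} (≡.subst (ℤS._∣_ (+ d)) offset+N+kd≡D d∣offset+N+kd)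
      where
      d∣N : d ∣ N
      d∣N = divides m N≡m*d
      d∣offset+N+kd : + d ℤS.∣ offset k ℤ.+ (+ N ℤ.+ + (k ℕ.* d))
      d∣offset+N+kd = ℤS.∣m∣n⇒∣m+n (ℤS.∣ᵤ⇒∣ {+ d} {offset k} (ℕD.∣-trans d∣N N∣offset))
                        (ℤS.∣m∣n⇒∣m+n (ℤS.∣ᵤ⇒∣ {+ d} {+ N} d∣N) (ℤS.∣ᵤ⇒∣ {+ d} {+ (k ℕ.* d)} (divides k ≡.refl)))
      offset+N+kd≡D : offset k ℤ.+ (+ N ℤ.+ + (k ℕ.* d)) ≡ + D
      offset+N+kd≡D = begin
        offset k ℤ.+ (+ N ℤ.+ + (k ℕ.* d))
          ≡⟨ ≡.cong (λ u → (u ℤ.- + (k ℕ.* d)) ℤ.+ (+ N ℤ.+ + (k ℕ.* d))) X-Y≡D-N ⟩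
        ((+ D ℤ.- + N) ℤ.- + (k ℕ.* d)) ℤ.+ (+ N ℤ.+ + (k ℕ.* d))
          ≡⟨ solve 3 (λ t n e → ((t :- n) :- e) :+ (n :+ e) := t) ≡.refl (+ D) (+ N) (+ (k ℕ.* d)) ⟩
        + D
          ∎

module _ {a ℓ : Level} (S : Setoid a ℓ) where
  open Setoid S

  covered⇒≤ : ∀ {k l} (A : Fin k → Carrier) (B : Fin l → Carrier) →
              (∀ i j → A i ≈ A j → i ≡ j) → (∀ i → ∃ λ j → A i ≈ B j) → k ≤ l
  covered⇒≤ A B A-inj cover = FinP.injective⇒≤ {f = λ i → proj₁ (cover i)} λ {i} {j} cover-i≡cover-j →
    A-inj i j (trans (proj₂ (cover i)) (trans (reflexive (≡.cong B cover-i≡cover-j)) (sym (proj₂ (cover j)))))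

module FiniteField {c ℓ : Level} (K : CommutativeRing c ℓ) {n : ℕ} (FK : IsFieldOfOrder K n) where
  open CommutativeRing K
  open IsFieldOfOrder FK
  open import Relation.Binary.Reasoning.Setoid setoid

  index : Carrier → Fin n
  index x = proj₁ (enum-sur x)

  index-injective : ∀ {x y} → index x ≡ index y → x ≈ y
  index-injective {x} {y} e = trans (sym (proj₂ (enum-sur x))) (trans (reflexive (≡.cong enum e)) (proj₂ (enum-sur y)))

  index-cong : ∀ {x y} → x ≈ y → index x ≡ index y
  index-cong {x} {y} x≈y = enum-inj _ _ (trans (proj₂ (enum-sur x)) (trans x≈y (sym (proj₂ (enum-sur y)))))

  _≈?_ : Decidable _≈_
  x ≈? y = map′ index-injective index-cong (index x FinP.≟ index y)

  enum-covers : ∀ x → ∃ λ i → x ≈ enum i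
  enum-covers x = map₂ sym (enum-sur x)

  injective⇒covers : (A : Fin n → Carrier) → (∀ i j → A i ≈ A j → i ≡ j) → ∀ u → ∃ λ i → u ≈ A i
  injective⇒covers A A-inj u with FinP.any? (λ i → u ≈? A i)
  ... | yes u∈A = u∈A
  ... | no  u∉A = ⊥-elim (ℕP.<-irrefl ≡.refl (covered⇒≤ setoid (u ∷ A) enum u∷A-inj (enum-covers ∘ (u ∷ A))))
    where
    u∷A-inj : ∀ i j → (u ∷ A) i ≈ (u ∷ A) j → i ≡ j
    u∷A-inj Fin.zero    Fin.zero    _ = ≡.refl
    u∷A-inj Fin.zero    (Fin.suc j) e = ⊥-elim (u∉A (j , e))
    u∷A-inj (Fin.suc i) Fin.zero    e = ⊥-elim (u∉A (i , sym e))
    u∷A-inj (Fin.suc i) (Fin.suc j) e = ≡.cong Fin.suc (A-inj i j e)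

  inv : ∀ x → x ≉ 0# → Carrier
  inv x x≉0 = proj₁ (inverse x x≉0)

  *-invʳ : ∀ x (x≉0 : x ≉ 0#) → x * inv x x≉0 ≈ 1#
  *-invʳ x x≉0 = proj₂ (inverse x x≉0)

  inv-cancelˡ : ∀ x (x≉0 : x ≉ 0#) y → inv x x≉0 * (x * y) ≈ y
  inv-cancelˡ x x≉0 y = begin
    inv x x≉0 * (x * y) ≈⟨ *-assoc _ _ _ ⟨
    inv x x≉0 * x * y   ≈⟨ *-congʳ (trans (*-comm _ _) (*-invʳ x x≉0)) ⟩
    1# * y              ≈⟨ *-identityˡ y ⟩
    y                   ∎

  *-cancelˡ : ∀ {x y z} → x ≉ 0# → x * y ≈ x * z → y ≈ z
  *-cancelˡ {x} {y} {z} x≉0 xy≈xz = begin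
    y                   ≈⟨ inv-cancelˡ x x≉0 y ⟨
    inv x x≉0 * (x * y) ≈⟨ *-congˡ xy≈xz ⟩
    inv x x≉0 * (x * z) ≈⟨ inv-cancelˡ x x≉0 z ⟩
    z                   ∎

  *-nonzero : ∀ {x y} → x ≉ 0# → y ≉ 0# → x * y ≉ 0#
  *-nonzero x≉0 y≉0 xy≈0 = y≉0 (*-cancelˡ x≉0 (trans xy≈0 (sym (zeroʳ _))))

module PrimitiveElement {c ℓ : Level} (K : CommutativeRing c ℓ) {n : ℕ} (FK : IsFieldOfOrder K n)
                        (θ : CommutativeRing.Carrier K) (prim : IsPrimitive K θ) where
  open CommutativeRing K
  open RawSemiringDefs (Algebra.Bundles.Semiring.rawSemiring semiring) using (_^_)
  open import Algebra.Properties.Semiring.Exp semiring using (^-homo-*; ^-assocʳ; ^-congˡ; ^-congʳ)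
  open IsFieldOfOrder FK using (1≉0; enum; enum-inj)
  open IsPrimitive prim
  open FiniteField K FK
  open import Relation.Binary.Reasoning.Setoid setoid

  N : ℕ
  N = n ∸ 1

  θ^≉0 : ∀ k → θ ^ k ≉ 0#
  θ^≉0 zero    = 1≉0
  θ^≉0 (suc k) = *-nonzero θ≉0 (θ^≉0 k)

  zeroOrPowerOf : ∀ {k} → ℕ → Fin (suc k) → Carrier
  zeroOrPowerOf s = 0# ∷ λ j → θ ^ (toℕ j ℕ.* s)

  1^k≈1 : ∀ k → 1# ^ k ≈ 1#
  1^k≈1 zero    = refl
  1^k≈1 (suc k) = trans (*-identityˡ _) (1^k≈1 k)

  module _ {e : ℕ} (θ^e≈1 : θ ^ e ≈ 1#) where

    ^-periodic : ∀ r k → θ ^ (r ℕ.+ k ℕ.* e) ≈ θ ^ r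
    ^-periodic r k = begin
      θ ^ (r ℕ.+ k ℕ.* e)     ≈⟨ ^-homo-* θ r (k ℕ.* e) ⟩
      θ ^ r * θ ^ (k ℕ.* e)   ≈⟨ *-congˡ (^-congʳ θ (ℕP.*-comm k e)) ⟩
      θ ^ r * θ ^ (e ℕ.* k)   ≈⟨ *-congˡ (^-assocʳ θ e k) ⟨
      θ ^ r * (θ ^ e) ^ k     ≈⟨ *-congˡ (trans (^-congˡ k θ^e≈1) (1^k≈1 k)) ⟩
      θ ^ r * 1#              ≈⟨ *-identityʳ _ ⟩
      θ ^ r                   ∎

    ^-% : .{{_ : NonZero e}} → ∀ a → θ ^ a ≈ θ ^ (a % e)
    ^-% a = trans (^-congʳ θ (m≡m%n+[m/n]*n a e)) (^-periodic (a % e) (a / e))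

    N≤period : .{{_ : NonZero e}} → N ≤ e
    N≤period = ℕP.∸-monoˡ-≤ 1 (covered⇒≤ setoid enum (zeroOrPowerOf 1) enum-inj zero-or-power)
      where
      zero-or-power : ∀ i → ∃ λ j → enum i ≈ zeroOrPowerOf 1 j
      zero-or-power i with enum i ≈? 0#
      ... | yes x≈0 = Fin.zero , x≈0
      ... | no  x≉0 = Fin.suc r , (begin
        enum i              ≈⟨ proj₂ (generates (enum i) x≉0) ⟨
        θ ^ k               ≈⟨ ^-% k ⟩
        θ ^ (k % e)         ≈⟨ ^-congʳ θ (≡.trans (ℕP.*-identityʳ _) (FinP.toℕ-fromℕ< (m%n<n k e))) ⟨
        θ ^ (toℕ r ℕ.* 1)   ∎)
        where
        k : ℕ
        k = proj₁ (generates (enum i) x≉0)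
        r : Fin e
        r = Fin.fromℕ< (m%n<n k e)

  θ^[j∸i]≈1 : ∀ {i j} → i ≤ j → θ ^ i ≈ θ ^ j → θ ^ (j ∸ i) ≈ 1#
  θ^[j∸i]≈1 {i} {j} i≤j θ^i≈θ^j = sym (*-cancelˡ (θ^≉0 i) (begin
    θ ^ i * 1#            ≈⟨ *-identityʳ _ ⟩
    θ ^ i                 ≈⟨ θ^i≈θ^j ⟩
    θ ^ j                 ≈⟨ ^-congʳ θ (ℕP.m+[n∸m]≡n i≤j) ⟨
    θ ^ (i ℕ.+ (j ∸ i))   ≈⟨ ^-homo-* θ i (j ∸ i) ⟩
    θ ^ i * θ ^ (j ∸ i)   ∎))

  period-exists : ∃ λ e → 0 < e × e ≤ N × θ ^ e ≈ 1#
  period-exists with FinP.pigeonhole (ℕP.n<1+n n) (index ∘ (0# ∷ λ i → θ ^ toℕ i))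
  ... | Fin.zero  , Fin.suc j , _        , 0≡θ^j   = ⊥-elim (θ^≉0 (toℕ j) (sym (index-injective 0≡θ^j)))
  ... | Fin.suc i , Fin.suc j , s≤s i<j , θ^i≡θ^j =
    toℕ j ∸ toℕ i , ℕP.m<n⇒0<n∸m i<j ,
    ℕP.≤-trans (ℕP.m∸n≤m (toℕ j) (toℕ i)) (ℕP.<⇒≤pred (FinP.toℕ<n j)) ,
    θ^[j∸i]≈1 (ℕP.<⇒≤ i<j) (index-injective θ^i≡θ^j)

  θ^N≈1 : θ ^ N ≈ 1#
  θ^N≈1 = let (e , 0<e , e≤N , θ^e≈1) = period-exists in
    ≡.subst (λ k → θ ^ k ≈ 1#) (ℕP.≤-antisym e≤N (N≤period θ^e≈1 {{ℕ.>-nonZero 0<e}})) θ^e≈1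

  instance
    N-nonZero : NonZero N
    N-nonZero = let (e , 0<e , e≤N , _) = period-exists in ℕ.>-nonZero (ℕP.<-≤-trans 0<e e≤N)

  log : ∀ x → x ≉ 0# → ℕ
  log x x≉0 = proj₁ (generates x x≉0) % N

  log<N : ∀ x (x≉0 : x ≉ 0#) → log x x≉0 < N
  log<N x x≉0 = m%n<n _ N

  θ^log : ∀ x (x≉0 : x ≉ 0#) → θ ^ log x x≉0 ≈ x
  θ^log x x≉0 = trans (sym (^-% θ^N≈1 _)) (proj₂ (generates x x≉0))

  θ^i≉θ^j : ∀ {i j} → i < j → j < N → θ ^ i ≉ θ ^ j
  θ^i≉θ^j {i} {j} i<j j<N θ^i≈θ^j = ℕP.<⇒≱ (ℕP.≤-<-trans (ℕP.m∸n≤m j i) j<N)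
    (N≤period (θ^[j∸i]≈1 (ℕP.<⇒≤ i<j) θ^i≈θ^j) {{ℕ.>-nonZero (ℕP.m<n⇒0<n∸m i<j)}})

  ^-injective : ∀ {a b} → a < N → b < N → θ ^ a ≈ θ ^ b → a ≡ b
  ^-injective {a} {b} a<N b<N θ^a≈θ^b with ℕP.<-cmp a b
  ... | tri< a<b _ _ = ⊥-elim (θ^i≉θ^j a<b b<N θ^a≈θ^b)
  ... | tri≈ _ a≡b _ = a≡b
  ... | tri> _ _ b<a = ⊥-elim (θ^i≉θ^j b<a a<N (sym θ^a≈θ^b))

  θ^[a+[N∸b]]*θ^b≈θ^a : ∀ a {b} → b ≤ N → θ ^ (a ℕ.+ (N ∸ b)) * θ ^ b ≈ θ ^ a
  θ^[a+[N∸b]]*θ^b≈θ^a a {b} b≤N = begin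
    θ ^ (a ℕ.+ (N ∸ b)) * θ ^ b    ≈⟨ ^-homo-* θ (a ℕ.+ (N ∸ b)) b ⟨
    θ ^ (a ℕ.+ (N ∸ b) ℕ.+ b)      ≈⟨ ^-congʳ θ (≡.trans (ℕP.+-assoc a (N ∸ b) b) (≡.cong (a ℕ.+_) (ℕP.m∸n+n≡m b≤N))) ⟩
    θ ^ (a ℕ.+ N)                  ≈⟨ ^-homo-* θ a N ⟩
    θ ^ a * θ ^ N                  ≈⟨ *-congˡ θ^N≈1 ⟩
    θ ^ a * 1#                     ≈⟨ *-identityʳ _ ⟩
    θ ^ a                          ∎

  θ^[a+d]≈θ^[a+[N∸b]]*θ^[d+b] : ∀ a d {b} → b ≤ N → θ ^ (a ℕ.+ d) ≈ θ ^ (a ℕ.+ (N ∸ b)) * θ ^ (d ℕ.+ b)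
  θ^[a+d]≈θ^[a+[N∸b]]*θ^[d+b] a d {b} b≤N = begin
    θ ^ (a ℕ.+ d)                                ≈⟨ ^-homo-* θ a d ⟩
    θ ^ a * θ ^ d                                ≈⟨ *-congʳ (θ^[a+[N∸b]]*θ^b≈θ^a a b≤N) ⟨
    θ ^ (a ℕ.+ (N ∸ b)) * θ ^ b * θ ^ d          ≈⟨ *-assoc _ _ _ ⟩
    θ ^ (a ℕ.+ (N ∸ b)) * (θ ^ b * θ ^ d)        ≈⟨ *-congˡ (trans (*-comm _ _) (sym (^-homo-* θ d b))) ⟩
    θ ^ (a ℕ.+ (N ∸ b)) * θ ^ (d ℕ.+ b)          ∎

  ∃θ^[z+b]≈ : ∀ (b : Fin N) v → v ≉ 0# → ∃ λ (z : Fin N) → θ ^ (toℕ z ℕ.+ toℕ b) ≈ v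
  ∃θ^[z+b]≈ b v v≉0 = z , (begin
    θ ^ (toℕ z ℕ.+ toℕ b)                         ≈⟨ ^-homo-* θ (toℕ z) (toℕ b) ⟩
    θ ^ toℕ z * θ ^ toℕ b                         ≈⟨ *-congʳ (^-congʳ θ (FinP.toℕ-fromℕ< z<N)) ⟩
    θ ^ (e % N) * θ ^ toℕ b                       ≈⟨ *-congʳ (^-% θ^N≈1 e) ⟨
    θ ^ e * θ ^ toℕ b                             ≈⟨ θ^[a+[N∸b]]*θ^b≈θ^a (log v v≉0) (ℕP.<⇒≤ (FinP.toℕ<n b)) ⟩
    θ ^ log v v≉0                                 ≈⟨ θ^log v v≉0 ⟩
    v                                             ∎)
    where
    e : ℕ
    e = log v v≉0 ℕ.+ (N ∸ toℕ b)
    z<N : e % N < N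
    z<N = m%n<n e N
    z : Fin N
    z = Fin.fromℕ< z<N

  zeroOrPowerOf-injective : ∀ {k s} .{{_ : NonZero s}} → k ℕ.* s ≤ N →
                            ∀ i j → zeroOrPowerOf {k} s i ≈ zeroOrPowerOf s j → i ≡ j
  zeroOrPowerOf-injective         ks≤N Fin.zero    Fin.zero    _ = ≡.refl
  zeroOrPowerOf-injective {s = s} ks≤N Fin.zero    (Fin.suc j) e = ⊥-elim (θ^≉0 (toℕ j ℕ.* s) (sym e))
  zeroOrPowerOf-injective {s = s} ks≤N (Fin.suc i) Fin.zero    e = ⊥-elim (θ^≉0 (toℕ i ℕ.* s) e)
  zeroOrPowerOf-injective {s = s} ks≤N (Fin.suc i) (Fin.suc j) e =
    ≡.cong Fin.suc (FinP.toℕ-injective (ℕP.*-cancelʳ-≡ _ _ s (^-injective (below-N i) (below-N j) e)))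
    where
    below-N : ∀ i → toℕ i ℕ.* s < N
    below-N i = ℕP.<-≤-trans (ℕP.*-monoˡ-< s (FinP.toℕ<n i)) ks≤N

module PrimitiveSubfield {c ℓ p : Level} (K : CommutativeRing c ℓ) {n : ℕ} (FK : IsFieldOfOrder K n)
                         (θ : CommutativeRing.Carrier K) (prim : IsPrimitive K θ)
                         (P : CommutativeRing.Carrier K → Set p) {m : ℕ} (SF : IsSubfieldOfOrder K P m) where
  open CommutativeRing K
  open RawSemiringDefs (Algebra.Bundles.Semiring.rawSemiring semiring) using (_^_)
  open import Algebra.Properties.Semiring.Exp semiring using (^-homo-*; ^-assocʳ; ^-congʳ)
  open IsSubfieldOfOrder SF
  open FiniteField K FK
  open PrimitiveElement K FK θ prim
  open import Relation.Binary.Reasoning.Setoid setoid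

  P? : U.Decidable P
  P? x = map′ (λ (i , enum-i≈x) → P-resp enum-i≈x (enum-P i)) (enum-sur x) (FinP.any? λ i → enum i ≈? x)

  P-^ : ∀ {x} k → P x → P (x ^ k)
  P-^ zero    Px = P-1
  P-^ (suc k) Px = P-* Px (P-^ k Px)

  P-θ^* : ∀ {s} → P (θ ^ s) → ∀ k → P (θ ^ (k ℕ.* s))
  P-θ^* {s} Pθ^s k = P-resp (trans (^-assocʳ θ s k) (^-congʳ θ (ℕP.*-comm s k))) (P-^ k Pθ^s)

  P-θ^-cancel : ∀ a b → P (θ ^ (a ℕ.+ b)) → P (θ ^ b) → P (θ ^ a)
  P-θ^-cancel a b Pθ^a+b Pθ^b = P-resp θ^[a+b]/θ^b≈θ^a (P-* Pθ^a+b (P-inv Pθ^b (*-invʳ _ (θ^≉0 b))))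
    where
    θ^[a+b]/θ^b≈θ^a : θ ^ (a ℕ.+ b) * inv (θ ^ b) (θ^≉0 b) ≈ θ ^ a
    θ^[a+b]/θ^b≈θ^a = begin
      θ ^ (a ℕ.+ b) * inv (θ ^ b) (θ^≉0 b)     ≈⟨ *-congʳ (^-homo-* θ a b) ⟩
      θ ^ a * θ ^ b * inv (θ ^ b) (θ^≉0 b)     ≈⟨ *-assoc _ _ _ ⟩
      θ ^ a * (θ ^ b * inv (θ ^ b) (θ^≉0 b))   ≈⟨ *-congˡ (*-invʳ _ (θ^≉0 b)) ⟩
      θ ^ a * 1#                               ≈⟨ *-identityʳ _ ⟩
      θ ^ a                                    ∎

  private
    least-exponent : ∃ λ k → P (θ ^ suc k) × ∀ j → j < k → ¬ P (θ ^ suc j)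
    least-exponent = least-witness (λ k → P? (θ ^ suc k)) {N ∸ 1}
                       (P-resp (sym (trans (^-congʳ θ (ℕP.suc-pred N)) θ^N≈1)) P-1)

  g : ℕ
  g = suc (proj₁ least-exponent)

  P-θ^g : P (θ ^ g)
  P-θ^g = proj₁ (proj₂ least-exponent)

  g-minimal : ∀ j → suc j < g → ¬ P (θ ^ suc j)
  g-minimal j 1+j<g = proj₂ (proj₂ least-exponent) j (ℕP.≤-pred 1+j<g)

  P-θ^⇒∣ : ∀ d → P (θ ^ d) → g ∣ d
  P-θ^⇒∣ d Pθ^d with d % g in d%g≡r
  ... | zero  = ℕD.m%n≡0⇒n∣m d g d%g≡r
  ... | suc r = ⊥-elim (g-minimal r (≡.subst (_< g) d%g≡r (m%n<n d g)) (≡.subst (P ∘ (θ ^_)) d%g≡r P-θ^[d%g]))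
    where
    P-θ^[d%g] : P (θ ^ (d % g))
    P-θ^[d%g] = P-θ^-cancel (d % g) (d / g ℕ.* g)
                  (≡.subst (P ∘ (θ ^_)) (m≡m%n+[m/n]*n d g) Pθ^d) (P-θ^* P-θ^g (d / g))

  ∣⇒P-θ^ : ∀ {d} → g ∣ d → P (θ ^ d)
  ∣⇒P-θ^ (divides k d≡kg) = ≡.subst (P ∘ (θ ^_)) (≡.sym d≡kg) (P-θ^* P-θ^g k)

  -- Counting P = {0} ∪ {θ ^ (j * g) : j < M} in both directions gives m = 1 + M.
  private
    g∣N : g ∣ N
    g∣N = P-θ^⇒∣ N (P-resp (sym θ^N≈1) P-1)

    M : ℕ
    M = ℕD.quotient g∣N

    N≡M*g : N ≡ M ℕ.* g
    N≡M*g = ℕD.m∣n⇒n≡quotient*m g∣N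

    m≤1+M : m ≤ suc M
    m≤1+M = covered⇒≤ setoid enum (zeroOrPowerOf g) enum-inj zero-or-power
      where
      zero-or-power : ∀ i → ∃ λ j → enum i ≈ zeroOrPowerOf g j
      zero-or-power i with enum i ≈? 0#
      ... | yes x≈0 = Fin.zero , x≈0
      ... | no  x≉0 with P-θ^⇒∣ (log (enum i) x≉0) (P-resp (sym (θ^log (enum i) x≉0)) (enum-P i))
      ...   | divides j k≡jg = Fin.suc (Fin.fromℕ< j<M) , (begin
        enum i                              ≈⟨ θ^log (enum i) x≉0 ⟨
        θ ^ log (enum i) x≉0                ≈⟨ ^-congʳ θ (≡.trans k≡jg (≡.cong (ℕ._* g) (≡.sym (FinP.toℕ-fromℕ< j<M)))) ⟩
        θ ^ (toℕ (Fin.fromℕ< j<M) ℕ.* g)   ∎)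
        where
        j<M : j < M
        j<M = ℕP.*-cancelʳ-< g j M (≡.subst₂ _<_ k≡jg N≡M*g (log<N (enum i) x≉0))

    1+M≤m : suc M ≤ m
    1+M≤m = covered⇒≤ setoid (zeroOrPowerOf g) enum
              (zeroOrPowerOf-injective (ℕP.≤-reflexive (≡.sym N≡M*g))) (enum-covers-P ∘ P-zeroOrPowerOf)
      where
      P-zeroOrPowerOf : ∀ j → P (zeroOrPowerOf {M} g j)
      P-zeroOrPowerOf Fin.zero    = P-0
      P-zeroOrPowerOf (Fin.suc j) = P-θ^* P-θ^g (toℕ j)
      enum-covers-P : ∀ {x} → P x → ∃ λ i → x ≈ enum i
      enum-covers-P Px = map₂ sym (enum-sur _ Px)

  N≡[m∸1]*g : N ≡ (m ∸ 1) ℕ.* g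
  N≡[m∸1]*g = ≡.trans N≡M*g (≡.cong (λ k → (k ∸ 1) ℕ.* g) (ℕP.≤-antisym 1+M≤m m≤1+M))

  -- θ ^ a and θ ^ b lie in the same coset of P*; on vertices this is the relation x − y ∈ H.
  infix 4 _∼_
  record _∼_ (a b : ℕ) : Set (c ⊔ ℓ ⊔ p) where
    constructor scaled
    field
      factor   : Carrier
      P-factor : P factor
      θ^a≈factor*θ^b : θ ^ a ≈ factor * θ ^ b

  ∼-refl : ∀ {a} → a ∼ a
  ∼-refl = scaled 1# P-1 (sym (*-identityˡ _))

  ∼-sym : ∀ {a b} → a ∼ b → b ∼ a
  ∼-sym {a} {b} (scaled u Pu θ^a≈uθ^b) = scaled (inv u u≉0) (P-inv Pu (*-invʳ u u≉0))
      (trans (sym (inv-cancelˡ u u≉0 (θ ^ b))) (*-congˡ (sym θ^a≈uθ^b)))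
    where
    u≉0 : u ≉ 0#
    u≉0 u≈0 = θ^≉0 a (trans θ^a≈uθ^b (trans (*-congʳ u≈0) (zeroˡ _)))

  ∼-trans : ∀ {a b d} → a ∼ b → b ∼ d → a ∼ d
  ∼-trans (scaled u Pu θ^a≈uθ^b) (scaled w Pw θ^b≈wθ^d) =
    scaled (u * w) (P-* Pu Pw) (trans θ^a≈uθ^b (trans (*-congˡ θ^b≈wθ^d) (sym (*-assoc _ _ _))))

  ∼⇔P : ∀ a {b} → b ≤ N → a ∼ b ⇔ P (θ ^ (a ℕ.+ (N ∸ b)))
  ∼⇔P a {b} b≤N = mk⇔
    (λ (scaled u Pu θ^a≈uθ^b) → P-resp (sym (*-cancelˡ (θ^≉0 b) (begin
      θ ^ b * θ ^ (a ℕ.+ (N ∸ b))   ≈⟨ *-comm _ _ ⟩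
      θ ^ (a ℕ.+ (N ∸ b)) * θ ^ b   ≈⟨ θ^[a+[N∸b]]*θ^b≈θ^a a b≤N ⟩
      θ ^ a                         ≈⟨ θ^a≈uθ^b ⟩
      u * θ ^ b                     ≈⟨ *-comm _ _ ⟩
      θ ^ b * u                     ∎))) Pu)
    (λ Pθ^[a+[N∸b]] → scaled _ Pθ^[a+[N∸b]] (sym (θ^[a+[N∸b]]*θ^b≈θ^a a b≤N)))

module QuadraticExtension {c ℓ p : Level} (K : CommutativeRing c ℓ) {q : ℕ} (FK : IsFieldOfOrder K (q ℕ.* q))
                          (P : CommutativeRing.Carrier K → Set p) (SF : IsSubfieldOfOrder K P q)
                          (θ : CommutativeRing.Carrier K) (θ∉P : ¬ P θ) where
  open CommutativeRing K
  open IsSubfieldOfOrder SF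
  open FiniteField K FK
  open import Algebra.Properties.Ring ring using ([y-z]x≈yx-zx)
  open import Algebra.Properties.Group (Algebra.Bundles.AbelianGroup.group +-abelianGroup)
    using (⁻¹-involutive; ∙-cancelˡ; x∙y⁻¹≈ε⇒x≈y)
  open import Algebra.Solver.CommutativeMonoid +-commutativeMonoid using (solve; _⊕_; _⊜_)
  open import Relation.Binary.Reasoning.Setoid setoid

  P-- : ∀ {x y} → P x → P y → P (x - y)
  P-- Px Py = P-+ Px (P-neg Py)

  x≈y+[x-y] : ∀ x y → x ≈ y + (x - y)
  x≈y+[x-y] x y = sym (begin
    y + (x - y)   ≈⟨ solve 3 (λ x y -y → (y ⊕ (x ⊕ -y)) ⊜ (x ⊕ (y ⊕ -y))) refl x y (- y) ⟩
    x + (y - y)   ≈⟨ +-congˡ (-‿inverseʳ y) ⟩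
    x + 0#        ≈⟨ +-identityʳ x ⟩
    x             ∎)

  a+b≈c+d⇒a-c≈d-b : ∀ {a b c d} → a + b ≈ c + d → a - c ≈ d - b
  a+b≈c+d⇒a-c≈d-b {a} {b} {c} {d} a+b≈c+d = begin
    a - c                  ≈⟨ +-identityʳ _ ⟨
    (a - c) + 0#           ≈⟨ +-congˡ (-‿inverseʳ b) ⟨
    (a - c) + (b - b)      ≈⟨ solve 4 (λ a b -b -c → ((a ⊕ -c) ⊕ (b ⊕ -b)) ⊜ ((a ⊕ b) ⊕ (-b ⊕ -c))) refl a b (- b) (- c) ⟩
    (a + b) + (- b - c)    ≈⟨ +-congʳ a+b≈c+d ⟩
    (c + d) + (- b - c)    ≈⟨ solve 4 (λ c d -b -c → ((c ⊕ d) ⊕ (-b ⊕ -c)) ⊜ ((d ⊕ -b) ⊕ (c ⊕ -c))) refl c d (- b) (- c) ⟩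
    (d - b) + (c - c)      ≈⟨ +-congˡ (-‿inverseʳ c) ⟩
    (d - b) + 0#           ≈⟨ +-identityʳ _ ⟩
    d - b                  ∎

  ¬P[a*θ] : ∀ {a} → P a → a ≉ 0# → ¬ P (a * θ)
  ¬P[a*θ] {a} Pa a≉0 Paθ = θ∉P (P-resp (inv-cancelˡ a a≉0 θ) (P-* (P-inv Pa (*-invʳ a a≉0)) Paθ))

  θ-basis-unique : ∀ {f h f′ h′} → P f → P h → P f′ → P h′ →
                   f * θ + h ≈ f′ * θ + h′ → f ≈ f′ × h ≈ h′
  θ-basis-unique {f} {h} {f′} {h′} Pf Ph Pf′ Ph′ e with f ≈? f′
  ... | yes f≈f′ = f≈f′ , ∙-cancelˡ (f * θ) h h′ (trans e (+-congʳ (*-congʳ (sym f≈f′))))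
  ... | no  f≉f′ = ⊥-elim (¬P[a*θ] (P-- Pf Pf′) (f≉f′ ∘ x∙y⁻¹≈ε⇒x≈y f f′)
                     (P-resp (sym (trans ([y-z]x≈yx-zx θ f f′) (a+b≈c+d⇒a-c≈d-b e))) (P-- Ph′ Ph)))

  θ-basis-covers : ∀ u → ∃₂ λ f h → P f × P h × u ≈ f * θ + h
  θ-basis-covers u = let (k , u≈A[k]) = injective⇒covers A A-injective u in
    enum (proj₁ (digits k)) , enum (proj₂ (digits k)) , enum-P _ , enum-P _ , u≈A[k]
    where
    digits : Fin (q ℕ.* q) → Fin q × Fin q
    digits = Fin.remQuot {q} q
    A : Fin (q ℕ.* q) → Carrier
    A k = enum (proj₁ (digits k)) * θ + enum (proj₂ (digits k))
    A-injective : ∀ k k′ → A k ≈ A k′ → k ≡ k′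
    A-injective k k′ A[k]≈A[k′] with θ-basis-unique (enum-P _) (enum-P _) (enum-P _) (enum-P _) A[k]≈A[k′]
    ... | f≈f′ , h≈h′ = ≡.trans (≡.sym (FinP.combine-remQuot {q} q k))
      (≡.trans (≡.cong (uncurry Fin.combine) (≡.cong₂ _,_ (enum-inj _ _ f≈f′) (enum-inj _ _ h≈h′)))
               (FinP.combine-remQuot {q} q k′))

  Inθ+P : Carrier → Set p
  Inθ+P u = P (u - θ)

  θ+s∈θ+P : ∀ {u s} → u ≈ θ + s → P s → Inθ+P u
  θ+s∈θ+P {u} {s} u≈θ+s Ps = P-resp (sym [θ+s]-θ≈s) Ps
    where
    [θ+s]-θ≈s : u - θ ≈ s
    [θ+s]-θ≈s = begin
      u - θ          ≈⟨ +-congʳ u≈θ+s ⟩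
      θ + s - θ      ≈⟨ solve 3 (λ θ s -θ → ((θ ⊕ s) ⊕ -θ) ⊜ (s ⊕ (θ ⊕ -θ))) refl θ s (- θ) ⟩
      s + (θ - θ)    ≈⟨ +-congˡ (-‿inverseʳ θ) ⟩
      s + 0#         ≈⟨ +-identityʳ s ⟩
      s              ∎

  Inθ+P-resp : ∀ {u w} → u ≈ w → Inθ+P u → Inθ+P w
  Inθ+P-resp u≈w = P-resp (+-congʳ u≈w)

  Inθ+P⇒≉0 : ∀ {u} → Inθ+P u → u ≉ 0#
  Inθ+P⇒≉0 {u} Pu-θ u≈0 = θ∉P (P-resp (⁻¹-involutive θ) (P-neg (P-resp [u-θ]-u≈-θ (P-- Pu-θ (P-resp (sym u≈0) P-0)))))
    where
    [u-θ]-u≈-θ : u - θ - u ≈ - θ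
    [u-θ]-u≈-θ = begin
      u - θ - u      ≈⟨ solve 3 (λ u -θ -u → ((u ⊕ -θ) ⊕ -u) ⊜ (-θ ⊕ (u ⊕ -u))) refl u (- θ) (- u) ⟩
      - θ + (u - u)  ≈⟨ +-congˡ (-‿inverseʳ u) ⟩
      - θ + 0#       ≈⟨ +-identityʳ (- θ) ⟩
      - θ            ∎

  scaling-θ+P⇒≈1 : ∀ {c v} → P c → Inθ+P v → Inθ+P (c * v) → c ≈ 1#
  scaling-θ+P⇒≈1 {c} {v} Pc Pv-θ Pcv-θ =
    proj₁ (θ-basis-unique Pc (P-* Pc Pv-θ) P-1 Pcv-θ (begin
      c * θ + c * (v - θ)   ≈⟨ distribˡ c θ (v - θ) ⟨
      c * (θ + (v - θ))     ≈⟨ *-congˡ (x≈y+[x-y] v θ) ⟨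
      c * v                 ≈⟨ x≈y+[x-y] (c * v) θ ⟩
      θ + (c * v - θ)       ≈⟨ +-congʳ (*-identityˡ θ) ⟨
      1# * θ + (c * v - θ)  ∎))

  scaling-into-θ+P : ∀ {u} → ¬ P u → ∃ λ v → Inθ+P v × Inθ+P (u * v)
  scaling-into-θ+P {u} u∉P with θ-basis-covers u | θ-basis-covers (u * θ)
  ... | f , h , Pf , Ph , u≈fθ+h | a , b , Pa , Pb , uθ≈aθ+b =
    θ + t , θ+s∈θ+P refl Pt , θ+s∈θ+P u[θ+t]≈θ+[b+th] (P-+ Pb (P-* Pt Ph))
    where
    f≉0 : f ≉ 0#
    f≉0 f≈0 = u∉P (P-resp (sym (begin
      u            ≈⟨ u≈fθ+h ⟩
      f * θ + h    ≈⟨ +-congʳ (trans (*-congʳ f≈0) (zeroˡ θ)) ⟩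
      0# + h       ≈⟨ +-identityˡ h ⟩
      h            ∎)) Ph)

    -- chosen so that the θ-coordinate a + t * f of u * (θ + t) is 1
    t : Carrier
    t = inv f f≉0 * (1# - a)

    Pt : P t
    Pt = P-* (P-inv Pf (*-invʳ f f≉0)) (P-- P-1 Pa)

    a+tf≈1 : a + t * f ≈ 1#
    a+tf≈1 = begin
      a + t * f                        ≈⟨ +-congˡ (*-comm t f) ⟩
      a + f * (inv f f≉0 * (1# - a))   ≈⟨ +-congˡ (*-assoc _ _ _) ⟨
      a + f * inv f f≉0 * (1# - a)     ≈⟨ +-congˡ (trans (*-congʳ (*-invʳ f f≉0)) (*-identityˡ _)) ⟩
      a + (1# - a)                     ≈⟨ solve 3 (λ a o -a → (a ⊕ (o ⊕ -a)) ⊜ (o ⊕ (a ⊕ -a))) refl a 1# (- a) ⟩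
      1# + (a - a)                     ≈⟨ +-congˡ (-‿inverseʳ a) ⟩
      1# + 0#                          ≈⟨ +-identityʳ 1# ⟩
      1#                               ∎

    u[θ+t]≈θ+[b+th] : u * (θ + t) ≈ θ + (b + t * h)
    u[θ+t]≈θ+[b+th] = begin
      u * (θ + t)                               ≈⟨ distribˡ u θ t ⟩
      u * θ + u * t                             ≈⟨ +-cong uθ≈aθ+b (*-comm u t) ⟩
      (a * θ + b) + t * u                       ≈⟨ +-congˡ (*-congˡ u≈fθ+h) ⟩
      (a * θ + b) + t * (f * θ + h)             ≈⟨ +-congˡ (distribˡ t _ _) ⟩
      (a * θ + b) + (t * (f * θ) + t * h)       ≈⟨ +-congˡ (+-congʳ (*-assoc t f θ)) ⟨
      (a * θ + b) + (t * f * θ + t * h)         ≈⟨ solve 4 (λ x y z w → ((x ⊕ y) ⊕ (z ⊕ w)) ⊜ ((x ⊕ z) ⊕ (y ⊕ w))) refl (a * θ) b (t * f * θ) (t * h) ⟩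
      (a * θ + t * f * θ) + (b + t * h)         ≈⟨ +-congʳ (distribʳ θ a (t * f)) ⟨
      (a + t * f) * θ + (b + t * h)             ≈⟨ +-congʳ (trans (*-congʳ a+tf≈1) (*-identityˡ θ)) ⟩
      θ + (b + t * h)                           ∎

module DistanceClassification {c ℓ p : Level} (K : CommutativeRing c ℓ) (q : ℕ)
                              (P : CommutativeRing.Carrier K → Set p) (θ : CommutativeRing.Carrier K) where

  CommonNeighbour : (x y : Fin (q ℕ.* q ∸ 1)) → Set p
  CommonNeighbour x y = ∃ λ z → Adj K q P θ x z × Adj K q P θ z y

  module Classification {x y : Fin (q ℕ.* q ∸ 1)} (x≢y : x ≢ y) {h : Level} {H : Set h} (H? : Dec H)
           (H⇒¬common : H → ¬ CommonNeighbour x y)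
           (¬H⇒common : ¬ InA K P θ (toℕ x ℕ.+ toℕ y) → ¬ H → CommonNeighbour x y)
           (H⇒walk₃ : ¬ InA K P θ (toℕ x ℕ.+ toℕ y) → H → Walk K q P θ x y 3) where

    private
      x+y∈A : Set p
      x+y∈A = InA K P θ (toℕ x ℕ.+ toℕ y)

      no-walk₀ : ¬ Walk K q P θ x y 0
      no-walk₀ here = x≢y ≡.refl

      walk₁⇒x+y∈A : Walk K q P θ x y 1 → x+y∈A
      walk₁⇒x+y∈A (step (_ , x+y∈A) here) = x+y∈A

      walk₂⇒common : Walk K q P θ x y 2 → CommonNeighbour x y
      walk₂⇒common (step x~z (step z~y here)) = _ , x~z , z~y

      common⇒walk₂ : CommonNeighbour x y → Walk K q P θ x y 2
      common⇒walk₂ (_ , x~z , z~y) = step x~z (step z~y here)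

      no-edge : ∀ {k} → (∀ m → m < k → ¬ Walk K q P θ x y m) → 1 < k → ¬ x+y∈A
      no-edge shorter 1<k x+y∈A = shorter 1 1<k (step (x≢y , x+y∈A) here)

    distance≡1 : Dist K q P θ x y 1 ⇔ x+y∈A
    distance≡1 = mk⇔ (walk₁⇒x+y∈A ∘ proj₁)
      λ x+y∈A → step (x≢y , x+y∈A) here , λ { zero _ → no-walk₀ ; (suc _) (s≤s ()) }

    distance≡2 : Dist K q P θ x y 2 ⇔ (¬ x+y∈A × ¬ H)
    distance≡2 = mk⇔
      (λ (w₂ , shorter) → no-edge shorter (s≤s (s≤s z≤n)) , λ h → H⇒¬common h (walk₂⇒common w₂))
      (λ (x+y∉A , ¬h) → common⇒walk₂ (¬H⇒common x+y∉A ¬h) , λ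
        { zero          _ → no-walk₀
        ; (suc zero)    _ → x+y∉A ∘ walk₁⇒x+y∈A
        ; (suc (suc _)) (s≤s (s≤s ())) })

    distance≡3 : Dist K q P θ x y 3 ⇔ (¬ x+y∈A × H)
    distance≡3 = mk⇔
      (λ (_ , shorter) → let x+y∉A = no-edge shorter (s≤s (s≤s z≤n)) in
        x+y∉A , decidable-stable H? (λ ¬h → shorter 2 (s≤s (s≤s (s≤s z≤n))) (common⇒walk₂ (¬H⇒common x+y∉A ¬h))))
      (λ (x+y∉A , h) → H⇒walk₃ x+y∉A h , λ
        { zero                _ → no-walk₀
        ; (suc zero)          _ → x+y∉A ∘ walk₁⇒x+y∈A
        ; (suc (suc zero))    _ → H⇒¬common h ∘ walk₂⇒common
        ; (suc (suc (suc _))) (s≤s (s≤s (s≤s ()))) })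

module Graph {c ℓ p : Level} {q : ℕ} (2≤q : 2 ≤ q)
             (K : CommutativeRing c ℓ) (FK : IsFieldOfOrder K (q ℕ.* q))
             (θ : CommutativeRing.Carrier K) (prim : IsPrimitive K θ)
             (P : CommutativeRing.Carrier K → Set p) (SF : IsSubfieldOfOrder K P q) where
  open CommutativeRing K
  open RawSemiringDefs (Algebra.Bundles.Semiring.rawSemiring semiring) using (_^_)
  open import Algebra.Properties.Semiring.Exp semiring using (^-homo-*; ^-congʳ)
  open import Algebra.Properties.Group (Algebra.Bundles.AbelianGroup.group +-abelianGroup) using (∙-cancelˡ)
  open IsFieldOfOrder FK using (1≉0)
  open IsSubfieldOfOrder SF using (P-resp; P-0; P-1)
  open PrimitiveElement K FK θ prim
  open PrimitiveSubfield K FK θ prim P SF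
  open DistanceClassification K q P θ using (CommonNeighbour)
  open import Relation.Binary.Reasoning.Setoid setoid

  g≡q+1 : g ≡ q ℕ.+ 1
  g≡q+1 = ℕP.*-cancelˡ-≡ g (q ℕ.+ 1) (q ∸ 1) {{ℕ.>-nonZero (ℕP.∸-monoˡ-< 2≤q (s≤s z≤n))}}
            (≡.trans (≡.sym N≡[m∸1]*g) (q*q∸1≡[q∸1]*[q+1] q))

  ∣⇔P-θ^ : ∀ d → q ℕ.+ 1 ∣ d ⇔ P (θ ^ d)
  ∣⇔P-θ^ d = mk⇔ (∣⇒P-θ^ ∘ ≡.subst (_∣ d) (≡.sym g≡q+1)) (≡.subst (_∣ d) g≡q+1 ∘ P-θ^⇒∣ d)

  θ∉P : ¬ P θ
  θ∉P Pθ = ℕP.<⇒≱ (ℕP.≤-trans 2≤q (ℕP.m≤m+n q 1)) (ℕD.∣⇒≤ (Equivalence.from (∣⇔P-θ^ 1) (P-resp (sym (*-identityʳ θ)) Pθ)))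

  open QuadraticExtension K FK P SF θ θ∉P

  Vertex : Set
  Vertex = Fin (q ℕ.* q ∸ 1)

  InH⇔P : (x y : Vertex) → InH q x y ⇔ P (θ ^ (toℕ x ℕ.+ (N ∸ toℕ y)))
  InH⇔P x y = ∣⇔P-θ^ _ ⇔-∘ ⇔-sym (∣X+[N∸Y]⇔X-Y∈d·ℤ/N (q*q∸1≡[q∸1]*[q+1] q) (FinP.toℕ<n x) (FinP.toℕ<n y))

  InH⇔∼ : (x y : Vertex) → InH q x y ⇔ toℕ x ∼ toℕ y
  InH⇔∼ x y = ⇔-sym (∼⇔P (toℕ x) (ℕP.<⇒≤ (FinP.toℕ<n y))) ⇔-∘ InH⇔P x y

  InH? : (x y : Vertex) → Dec (InH q x y)
  InH? x y = Dec.map (⇔-sym (InH⇔P x y)) (P? _)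

  x+y∈A : Vertex → Vertex → Set p
  x+y∈A x y = InA K P θ (toℕ x ℕ.+ toℕ y)

  ∼-common⇒θ^≈ : ∀ {a b} d → a ∼ b → Inθ+P (θ ^ (a ℕ.+ d)) → Inθ+P (θ ^ (d ℕ.+ b)) → θ ^ a ≈ θ ^ b
  ∼-common⇒θ^≈ {a} {b} d (scaled u Pu θ^a≈uθ^b) a+d∈A d+b∈A = begin
    θ ^ a        ≈⟨ θ^a≈uθ^b ⟩
    u * θ ^ b    ≈⟨ *-congʳ (scaling-θ+P⇒≈1 Pu d+b∈A (Inθ+P-resp θ^[a+d]≈uθ^[d+b] a+d∈A)) ⟩
    1# * θ ^ b   ≈⟨ *-identityˡ _ ⟩
    θ ^ b        ∎
    where
    θ^[a+d]≈uθ^[d+b] : θ ^ (a ℕ.+ d) ≈ u * θ ^ (d ℕ.+ b)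
    θ^[a+d]≈uθ^[d+b] = begin
      θ ^ (a ℕ.+ d)          ≈⟨ ^-homo-* θ a d ⟩
      θ ^ a * θ ^ d          ≈⟨ *-congʳ θ^a≈uθ^b ⟩
      u * θ ^ b * θ ^ d      ≈⟨ *-assoc _ _ _ ⟩
      u * (θ ^ b * θ ^ d)    ≈⟨ *-congˡ (trans (*-comm _ _) (sym (^-homo-* θ d b))) ⟩
      u * θ ^ (d ℕ.+ b)      ∎

  InH⇒¬common : ∀ {x y} → x ≢ y → InH q x y → ¬ CommonNeighbour x y
  InH⇒¬common {x} {y} x≢y x-y∈H (z , (_ , x+z∈A) , (_ , z+y∈A)) =
    x≢y (FinP.toℕ-injective (^-injective (FinP.toℕ<n x) (FinP.toℕ<n y)
      (∼-common⇒θ^≈ (toℕ z) (Equivalence.to (InH⇔∼ x y) x-y∈H) x+z∈A z+y∈A)))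

  common-neighbour-via : ∀ {x y v} → ¬ x+y∈A x y → Inθ+P v → Inθ+P (θ ^ (toℕ x ℕ.+ (N ∸ toℕ y)) * v) →
                         ∀ z → θ ^ (toℕ z ℕ.+ toℕ y) ≈ v → CommonNeighbour x y
  common-neighbour-via {x} {y} x+y∉A v∈θ+P uv∈θ+P z θ^[z+y]≈v = z , (x≢z , x+z∈A) , (z≢y , z+y∈A)
    where
    z+y∈A : x+y∈A z y
    z+y∈A = Inθ+P-resp (sym θ^[z+y]≈v) v∈θ+P
    x+z∈A : x+y∈A x z
    x+z∈A = Inθ+P-resp (sym (trans (θ^[a+d]≈θ^[a+[N∸b]]*θ^[d+b] (toℕ x) (toℕ z) (ℕP.<⇒≤ (FinP.toℕ<n y)))
                                   (*-congˡ θ^[z+y]≈v))) uv∈θ+P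
    x≢z : x ≢ z
    x≢z ≡.refl = x+y∉A z+y∈A
    z≢y : z ≢ y
    z≢y ≡.refl = x+y∉A x+z∈A

  ¬InA⇒¬InH⇒common : ∀ {x y} → ¬ x+y∈A x y → ¬ InH q x y → CommonNeighbour x y
  ¬InA⇒¬InH⇒common {x} {y} x+y∉A x-y∉H =
    let (v , v∈θ+P , uv∈θ+P) = scaling-into-θ+P (λ P[u] → x-y∉H (Equivalence.from (InH⇔P x y) P[u]))
        (z , θ^[z+y]≈v)      = ∃θ^[z+b]≈ y v (Inθ+P⇒≉0 v∈θ+P)
    in common-neighbour-via x+y∉A v∈θ+P uv∈θ+P z θ^[z+y]≈v

  module _ {x y : Vertex} (x≢y : x ≢ y) (x+y∉A : ¬ x+y∈A x y) (x-y∈H : InH q x y) where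
    private
      x+z∈A-swap : ∀ z → Inθ+P (θ ^ (toℕ z ℕ.+ toℕ x)) → x+y∈A x z
      x+z∈A-swap z = Inθ+P-resp (^-congʳ θ (ℕP.+-comm (toℕ z) (toℕ x)))

      walk-through : ∀ z → x+y∈A x z → x ≢ z → ¬ InH q z y → Walk K q P θ x y 3
      walk-through z x+z∈A x≢z z-y∉H =
        let (w , z~w , w~y) = ¬InA⇒¬InH⇒common z+y∉A z-y∉H in step (x≢z , x+z∈A) (step z~w (step w~y here))
        where
        z+y∉A : ¬ x+y∈A z y
        z+y∉A z+y∈A = InH⇒¬common x≢y x-y∈H (z , (x≢z , x+z∈A) , (z≢y , z+y∈A))
          where
          z≢y : z ≢ y
          z≢y ≡.refl = x+y∉A x+z∈A

      usable-or-∼ : ∀ z → Dec (x ≡ z) → Dec (InH q z y) → (x ≢ z × ¬ InH q z y) ⊎ toℕ z ∼ toℕ x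
      usable-or-∼ z (yes ≡.refl) _             = inj₂ ∼-refl
      usable-or-∼ z (no  x≢z)    (no z-y∉H)   = inj₁ (x≢z , z-y∉H)
      usable-or-∼ z (no  _)      (yes z-y∈H)  =
        inj₂ (∼-trans (Equivalence.to (InH⇔∼ z y) z-y∈H) (∼-sym (Equivalence.to (InH⇔∼ x y) x-y∈H)))

      -- If neither z₀ nor z₁ is usable, both are ∼ x, and x is a common neighbour of z₀ and z₁;
      -- then θ ^ z₀ ≈ θ ^ z₁, which would make θ + 0# ≈ θ + 1#.
      one-usable : ∀ z₀ z₁ → θ ^ (toℕ z₀ ℕ.+ toℕ x) ≈ θ + 0# → θ ^ (toℕ z₁ ℕ.+ toℕ x) ≈ θ + 1# →
                   (x ≢ z₀ × ¬ InH q z₀ y) ⊎ toℕ z₀ ∼ toℕ x → (x ≢ z₁ × ¬ InH q z₁ y) ⊎ toℕ z₁ ∼ toℕ x →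
                   Walk K q P θ x y 3
      one-usable z₀ z₁ e₀ e₁ (inj₁ (x≢z₀ , z₀-y∉H)) _ = walk-through z₀ (x+z∈A-swap z₀ (θ+s∈θ+P e₀ P-0)) x≢z₀ z₀-y∉H
      one-usable z₀ z₁ e₀ e₁ _ (inj₁ (x≢z₁ , z₁-y∉H)) = walk-through z₁ (x+z∈A-swap z₁ (θ+s∈θ+P e₁ P-1)) x≢z₁ z₁-y∉H
      one-usable z₀ z₁ e₀ e₁ (inj₂ z₀∼x) (inj₂ z₁∼x) = ⊥-elim (1≉0 (sym (∙-cancelˡ θ 0# 1# (begin
        θ + 0#                          ≈⟨ e₀ ⟨
        θ ^ (toℕ z₀ ℕ.+ toℕ x)          ≈⟨ ^-homo-* θ (toℕ z₀) (toℕ x) ⟩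
        θ ^ toℕ z₀ * θ ^ toℕ x          ≈⟨ *-congʳ θ^z₀≈θ^z₁ ⟩
        θ ^ toℕ z₁ * θ ^ toℕ x          ≈⟨ ^-homo-* θ (toℕ z₁) (toℕ x) ⟨
        θ ^ (toℕ z₁ ℕ.+ toℕ x)          ≈⟨ e₁ ⟩
        θ + 1#                          ∎))))
        where
        θ^z₀≈θ^z₁ : θ ^ toℕ z₀ ≈ θ ^ toℕ z₁
        θ^z₀≈θ^z₁ = ∼-common⇒θ^≈ (toℕ x) (∼-trans z₀∼x (∼-sym z₁∼x)) (θ+s∈θ+P e₀ P-0) (x+z∈A-swap z₁ (θ+s∈θ+P e₁ P-1))

      neighbour-with-sum : ∀ s → P s → ∃ λ z → θ ^ (toℕ z ℕ.+ toℕ x) ≈ θ + s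
      neighbour-with-sum s Ps = ∃θ^[z+b]≈ x (θ + s) (Inθ+P⇒≉0 (θ+s∈θ+P refl Ps))

    walk₃ : Walk K q P θ x y 3
    walk₃ =
      let (z₀ , e₀) = neighbour-with-sum 0# P-0
          (z₁ , e₁) = neighbour-with-sum 1# P-1
      in one-usable z₀ z₁ e₀ e₁ (usable-or-∼ z₀ (x FinP.≟ z₀) (InH? z₀ y)) (usable-or-∼ z₁ (x FinP.≟ z₁) (InH? z₁ y))

open import Data.Nat using (_+_; _*_)

lemma5p1 : ∀ {c ℓ p : Level} (q : ℕ) → IsPrimePower q →
    (K : CommutativeRing c ℓ) → IsFieldOfOrder K (q * q) →
    (P : CommutativeRing.Carrier K → Set p) → IsSubfieldOfOrder K P q →
    (θ : CommutativeRing.Carrier K) → IsPrimitive K θ →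
    (x y : Fin (q * q ∸ 1)) → x ≢ y →
    (Dist K q P θ x y 1 ⇔ InA K P θ (toℕ x + toℕ y))
    × (Dist K q P θ x y 2 ⇔ (¬ InA K P θ (toℕ x + toℕ y) × ¬ InH q x y))
    × (Dist K q P θ x y 3 ⇔ (¬ InA K P θ (toℕ x + toℕ y) × InH q x y))
lemma5p1 zero          _ _ _ _ _ _ _ () _ _
lemma5p1 (suc zero)    _ _ _ _ _ _ _ () _ _
lemma5p1 q@(suc (suc _)) _ K FK P SF θ prim x y x≢y = distance≡1 , distance≡2 , distance≡3
  where
  open Graph (s≤s (s≤s z≤n)) K FK θ prim P SF
  open DistanceClassification K q P θ
  open Classification x≢y (InH? x y) (InH⇒¬common x≢y) ¬InA⇒¬InH⇒common (walk₃ x≢y)
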